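{- For every integer $r \geq 4$ there exists $n_0 = n_0(r)$ such that the following holds for every $n \geq n_0$. Let $G$ be a graph on $n$ vertices with $\delta(G) \geq \lfloor n/2 \rfloor + (r-3)$. If there is a set $A \subseteq V(G)$ with $|A| = \lfloor n/2 \rfloor - 1$ and $\langle A \rangle_r = A$, then $m(G, r) = r$.
   Context: Graphs are finite and simple; $\delta(G)$ is the minimum degree and $N(v)$ the neighbourhood of $v$. For an integer $r \geq 2$, the $r$-neighbour bootstrap process on $G$ started from $A \subseteq V(G)$ is defined by $A_0 = A$ and $A_t = A_{t-1} \cup \{v \in V(G) : |N(v) \cap A_{t-1}| \geq r\}$ for $t \geq 1$. The closure is $\langle A \rangle_r = \bigcup_{t \geq 0} A_t$. The set $A$ percolates if $\langle A \rangle_r = V(G)$. Define $m(G,r) = \min\{|A| : A \subseteq V(G),\ \langle A \rangle_r = V(G)\}$. -}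

module Defs where

open import Data.Nat using (ℕ; zero; suc; _≤_; _≥_)
open import Data.Bool using (Bool; true; false; T)
open import Data.Fin using (Fin)
open import Data.Fin.Subset using (Subset; _∩_; ∣_∣; _∈_)
open import Data.Vec using (Vec; tabulate; zipWith)
open import Data.Bool using (_∨_)
open import Data.Product using (∃; _×_)
open import Relation.Binary.PropositionalEquality using (_≡_)
open import Relation.Nullary using (¬_)
open import Relation.Nullary.Decidable using (⌊_⌋)
open import Data.Nat using (_≤?_)

record Graph (n : ℕ) : Set where
  field
    adj   : Fin n → Fin n → Bool
    sym   : ∀ u v → adj u v ≡ adj v u
    irrefl : ∀ v → adj v v ≡ false

open Graph public

N : ∀ {n} → Graph n → Fin n → Subset n
N G v = tabulate (adj G v)

deg : ∀ {n} → Graph n → Fin n → ℕ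
deg G v = ∣ N G v ∣

MinDegAtLeast : ∀ {n} → Graph n → ℕ → Set
MinDegAtLeast G d = ∀ v → d ≤ deg G v

step : ∀ {n} → Graph n → ℕ → Subset n → Subset n
step G r A = zipWith _∨_ A (tabulate (λ v → ⌊ r ≤? ∣ N G v ∩ A ∣ ⌋))

stage : ∀ {n} → Graph n → ℕ → Subset n → ℕ → Subset n
stage G r A zero    = A
stage G r A (suc t) = step G r (stage G r A t)

InClosure : ∀ {n} → Graph n → ℕ → Subset n → Fin n → Set
InClosure G r A v = ∃ λ t → v ∈ stage G r A t

Closed : ∀ {n} → Graph n → ℕ → Subset n → Set
Closed G r A = ∀ v → InClosure G r A v → v ∈ A

Percolates : ∀ {n} → Graph n → ℕ → Subset n → Set
Percolates G r A = ∀ v → InClosure G r A v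

MinPercolating≡ : ∀ {n} → Graph n → ℕ → ℕ → Set
MinPercolating≡ G r k =
  (∃ λ A → Percolates G r A × ∣ A ∣ ≡ k) ×
  (∀ A → Percolates G r A → k ≤ ∣ A ∣)

-- Write r = m + 4 and α = ∣A∣, so that ⌊n/2⌋ = α + 1 and n ≤ 2α + 3. Closedness of A
-- bounds the number of neighbours in A of every outside vertex by r − 1, and with the
-- degree condition every vertex of A has at least r − 1 neighbours outside A. Double
-- counting the edges between A and its complement shows that many vertices of A have
-- exactly r − 1 outside neighbours (the set Q; such a vertex is adjacent to all of A)
-- and that at least seven outside vertices have exactly r − 1 neighbours in A (the set P).
-- Seed the process with some b₀ ∈ P and r − 1 vertices of Q avoiding a neighbour a₁ ∈ A
-- of b₀: then a₁, all of Q, all of A and the neighbours of b₀ in P are infected in turn,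
-- after which fewer than α vertices are uninfected and the degree condition infects them
-- all. Conversely, a set of fewer than r vertices never grows, so it cannot percolate.

module Submission where

open import Defs

import Algebra.Properties.CommutativeSemigroup
open import Data.Bool.Base using (Bool; true; T; if_then_else_)
open import Data.Fin.Base using (Fin; zero; suc)
import Data.Fin.Properties as Fin
open import Data.Fin.Subset
  using (Subset; inside; outside; ⊤; ⊥; _∈_; _∉_; _⊆_; _∩_; _∪_; ∁; ⁅_⁆; _-_; ∣_∣; Nonempty)
open import Data.Fin.Subset.Properties
  using ( _∈?_; x∈⁅x⁆; x∈⁅y⁆⇒x≡y; ∣⁅x⁆∣≡1; ⊥⊆; ∣⊥∣≡0; ∣⊤∣≡n; Empty-unique; ∣p∣≤n; ∣∁p∣≡n∸∣p∣
        ; ⊆-refl; s⊆s; p⊆q⇒∣p∣≤∣q∣; x∈∁p⇒x∉p; x∉p⇒x∈∁p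
        ; x∈p∩q⁺; x∈p∩q⁻; p∩q⊆p; p∩q⊆q; ∣p∩q∣≤∣q∣; x∈p∪q⁻; p⊆p∪q; q⊆p∪q
        ; p─⊥≡p; p─q⊆p; x∈p∧x≢y⇒x∈p-y; x∈p⇒∣p-x∣<∣p∣ )
open import Data.Nat.Base
  using (ℕ; zero; suc; _+_; _*_; _∸_; _/_; _%_; _≤_; _≥_; _<_; z≤n; s≤s; _≤′_; ≤′-refl; ≤′-step)
open import Data.Nat.DivMod using (m≡m%n+[m/n]*n; m%n<n; m*n/n≡m; /-monoˡ-≤)
open import Data.Nat.Properties
  using ( _<?_; _≤?_; ≤-trans; ≤-reflexive; ≤-<-trans; ≤-pred; <⇒≱; ≰⇒>; ≮⇒≥; ≤⇒≤′; n≤1+n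
        ; m≤n⇒m≤1+n; m≤n+m; m≤m+n; m≤m*n; +-suc; +-assoc; +-comm; +-identityʳ; *-suc; *-zeroʳ
        ; *-distribˡ-+; +-mono-≤; +-monoˡ-≤; +-monoʳ-≤; *-monoʳ-≤; +-cancelˡ-≤; +-cancelʳ-≤
        ; m+[n∸m]≡n; +-commutativeSemigroup; module ≤-Reasoning )
open import Data.Nat.Tactic.RingSolver using (solve-∀)
open import Data.Product.Base using (∃; _×_; _,_; proj₁; proj₂)
open import Data.Sum.Base using (inj₁; inj₂)
open import Data.Unit.Base using (tt)
open import Data.Vec.Base using ([]; _∷_; lookup; tabulate; here; there)
open import Data.Vec.Properties using (lookup∘tabulate; []=⇒lookup; lookup⇒[]=)
open import Function.Base using (_∘_)
open import Relation.Binary.PropositionalEquality as ≡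
  using (_≡_; _≢_; refl; cong; cong₂; trans; subst; module ≡-Reasoning)
open import Relation.Nullary using (yes; no; contradiction)
open import Relation.Nullary.Decidable using (⌊_⌋; dec-true; isYes≗does; toWitness)
open import Relation.Unary using (Pred; Decidable)

open Algebra.Properties.CommutativeSemigroup +-commutativeSemigroup
  using (interchange; x∙yz≈yx∙z; xy∙z≈xz∙y)

private variable
  m n : ℕ
  p q s : Subset n
  x y : Fin n

⟪_⟫ : ∀ {ℓ} {P : Pred (Fin n) ℓ} → Decidable P → Subset n
⟪ P? ⟫ = tabulate (λ x → ⌊ P? x ⌋)

module _ {ℓ} {P : Pred (Fin n) ℓ} (P? : Decidable P) where

  x∈⟪P⟫⁺ : P x → x ∈ ⟪ P? ⟫
  x∈⟪P⟫⁺ {x} px = lookup⇒[]= x _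
    (trans (lookup∘tabulate _ x) (trans (isYes≗does (P? x)) (dec-true (P? x) px)))

  x∈⟪P⟫⁻ : x ∈ ⟪ P? ⟫ → P x
  x∈⟪P⟫⁻ {x} x∈ = toWitness (subst T (≡.sym ⌊P?x⌋≡true) tt)
    where
    ⌊P?x⌋≡true : ⌊ P? x ⌋ ≡ true
    ⌊P?x⌋≡true = trans (≡.sym (lookup∘tabulate _ x)) ([]=⇒lookup x∈)

∣p∣≡∣p∩q∣+∣p∩∁q∣ : ∀ (p q : Subset n) → ∣ p ∣ ≡ ∣ p ∩ q ∣ + ∣ p ∩ ∁ q ∣
∣p∣≡∣p∩q∣+∣p∩∁q∣ []            []            = refl
∣p∣≡∣p∩q∣+∣p∩∁q∣ (outside ∷ p) (_ ∷ q)       = ∣p∣≡∣p∩q∣+∣p∩∁q∣ p q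
∣p∣≡∣p∩q∣+∣p∩∁q∣ (inside ∷ p)  (inside ∷ q)  = cong suc (∣p∣≡∣p∩q∣+∣p∩∁q∣ p q)
∣p∣≡∣p∩q∣+∣p∩∁q∣ (inside ∷ p)  (outside ∷ q) =
  trans (cong suc (∣p∣≡∣p∩q∣+∣p∩∁q∣ p q)) (≡.sym (+-suc _ _))

∣p∪q∣+∣p∩q∣≡∣p∣+∣q∣ : ∀ (p q : Subset n) → ∣ p ∪ q ∣ + ∣ p ∩ q ∣ ≡ ∣ p ∣ + ∣ q ∣
∣p∪q∣+∣p∩q∣≡∣p∣+∣q∣ []            []            = refl
∣p∪q∣+∣p∩q∣≡∣p∣+∣q∣ (outside ∷ p) (outside ∷ q) = ∣p∪q∣+∣p∩q∣≡∣p∣+∣q∣ p q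
∣p∪q∣+∣p∩q∣≡∣p∣+∣q∣ (inside ∷ p)  (outside ∷ q) = cong suc (∣p∪q∣+∣p∩q∣≡∣p∣+∣q∣ p q)
∣p∪q∣+∣p∩q∣≡∣p∣+∣q∣ (outside ∷ p) (inside ∷ q)  =
  trans (cong suc (∣p∪q∣+∣p∩q∣≡∣p∣+∣q∣ p q)) (≡.sym (+-suc _ _))
∣p∪q∣+∣p∩q∣≡∣p∣+∣q∣ (inside ∷ p)  (inside ∷ q)  =
  cong suc (trans (+-suc _ _) (trans (cong suc (∣p∪q∣+∣p∩q∣≡∣p∣+∣q∣ p q)) (≡.sym (+-suc _ _))))

∣p∪q∣≡∣p∣+∣q∣ : ∀ (p q : Subset n) → (∀ {x} → x ∈ p → x ∉ q) → ∣ p ∪ q ∣ ≡ ∣ p ∣ + ∣ q ∣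
∣p∪q∣≡∣p∣+∣q∣ {n} p q disjoint = begin
  ∣ p ∪ q ∣               ≡⟨ ≡.sym (+-identityʳ _) ⟩
  ∣ p ∪ q ∣ + 0           ≡⟨ cong (∣ p ∪ q ∣ +_) ∣p∩q∣≡0 ⟨
  ∣ p ∪ q ∣ + ∣ p ∩ q ∣   ≡⟨ ∣p∪q∣+∣p∩q∣≡∣p∣+∣q∣ p q ⟩
  ∣ p ∣ + ∣ q ∣           ∎
  where
  open ≡-Reasoning
  ∣p∩q∣≡0 : ∣ p ∩ q ∣ ≡ 0
  ∣p∩q∣≡0 = trans (cong ∣_∣ (Empty-unique λ (x , x∈p∩q) →
    let (x∈p , x∈q) = x∈p∩q⁻ p q x∈p∩q in disjoint x∈p x∈q)) (∣⊥∣≡0 n)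

∣⁅x⁆∪p∣≡1+∣p∣ : ∀ (p : Subset n) → x ∉ p → ∣ ⁅ x ⁆ ∪ p ∣ ≡ suc ∣ p ∣
∣⁅x⁆∪p∣≡1+∣p∣ {x = x} p x∉p =
  trans (∣p∪q∣≡∣p∣+∣q∣ ⁅ x ⁆ p λ y∈⁅x⁆ → subst (_∉ p) (≡.sym (x∈⁅y⁆⇒x≡y x y∈⁅x⁆)) x∉p)
        (cong (_+ ∣ p ∣) (∣⁅x⁆∣≡1 x))

⁅x⁆⊆p : x ∈ p → ⁅ x ⁆ ⊆ p
⁅x⁆⊆p {x = x} {p = p} x∈p y∈⁅x⁆ = subst (_∈ p) (≡.sym (x∈⁅y⁆⇒x≡y x y∈⁅x⁆)) x∈p

∪⊆ : p ⊆ s → q ⊆ s → p ∪ q ⊆ s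
∪⊆ {p = p} {q = q} p⊆s q⊆s x∈p∪q with x∈p∪q⁻ p q x∈p∪q
... | inj₁ x∈p = p⊆s x∈p
... | inj₂ x∈q = q⊆s x∈q

∣p∣+∣∁p∣≡n : ∀ (p : Subset n) → ∣ p ∣ + ∣ ∁ p ∣ ≡ n
∣p∣+∣∁p∣≡n p = trans (cong (∣ p ∣ +_) (∣∁p∣≡n∸∣p∣ p)) (m+[n∸m]≡n (∣p∣≤n p))

⊆-∩ : s ⊆ p → s ⊆ q → s ⊆ p ∩ q
⊆-∩ s⊆p s⊆q x∈s = x∈p∩q⁺ (s⊆p x∈s , s⊆q x∈s)

p⊆q∧∣q∣≤∣p∣⇒q⊆p : p ⊆ q → ∣ q ∣ ≤ ∣ p ∣ → q ⊆ p
p⊆q∧∣q∣≤∣p∣⇒q⊆p {p = p} {q = q} p⊆q ∣q∣≤∣p∣ {x} x∈q with x ∈? p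
... | yes x∈p = x∈p
... | no  x∉p = contradiction ∣q∣≤∣p∣ (<⇒≱ (≤-<-trans ∣p∣≤∣q-x∣ (x∈p⇒∣p-x∣<∣p∣ x∈q)))
  where
  ∣p∣≤∣q-x∣ : ∣ p ∣ ≤ ∣ q - x ∣
  ∣p∣≤∣q-x∣ = p⊆q⇒∣p∣≤∣q∣ λ {y} y∈p → x∈p∧x≢y⇒x∈p-y {p = q} {y = x} (p⊆q y∈p) λ { refl → x∉p y∈p }

∣p∣>0⇒Nonempty : ∀ (p : Subset n) → 0 < ∣ p ∣ → Nonempty p
∣p∣>0⇒Nonempty (inside ∷ p)  _ = zero , here
∣p∣>0⇒Nonempty (outside ∷ p) ∣p∣>0 =
  let (x , x∈p) = ∣p∣>0⇒Nonempty p ∣p∣>0 in suc x , there x∈p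

∃-⊆-of-size : ∀ (p : Subset n) {k} → k ≤ ∣ p ∣ → ∃ λ q → q ⊆ p × ∣ q ∣ ≡ k
∃-⊆-of-size {n} p {zero} _ = ⊥ , ⊥⊆ , ∣⊥∣≡0 n
∃-⊆-of-size (inside ∷ p) {suc k} k<∣p∣ =
  let (q , q⊆p , ∣q∣≡k) = ∃-⊆-of-size p (≤-pred k<∣p∣) in inside ∷ q , s⊆s q⊆p , cong suc ∣q∣≡k
∃-⊆-of-size (outside ∷ p) {suc k} k<∣p∣ =
  let (q , q⊆p , ∣q∣≡k) = ∃-⊆-of-size p k<∣p∣ in outside ∷ q , s⊆s q⊆p , ∣q∣≡k

x∉p-x : ∀ (p : Subset n) x → x ∉ p - x
x∉p-x (_ ∷ p) (suc x) (there x∈p-x) = x∉p-x p x x∈p-x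

x∈p-y⁻ : ∀ {p : Subset n} {x y} → x ∈ p - y → x ∈ p × x ≢ y
x∈p-y⁻ {p = p} {y = y} x∈p-y = p─q⊆p p ⁅ y ⁆ x∈p-y , λ { refl → x∉p-x p y x∈p-y }

∣p∣≤1+∣p-x∣ : ∀ (p : Subset n) x → ∣ p ∣ ≤ suc ∣ p - x ∣
∣p∣≤1+∣p-x∣ (inside ∷ p)  zero    = s≤s (≤-reflexive (≡.sym (cong ∣_∣ (p─⊥≡p p))))
∣p∣≤1+∣p-x∣ (outside ∷ p) zero    = m≤n⇒m≤1+n (≤-reflexive (≡.sym (cong ∣_∣ (p─⊥≡p p))))
∣p∣≤1+∣p-x∣ (inside ∷ p)  (suc x) = s≤s (∣p∣≤1+∣p-x∣ p x)
∣p∣≤1+∣p-x∣ (outside ∷ p) (suc x) = ∣p∣≤1+∣p-x∣ p x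

∑∈ : Subset n → (Fin n → ℕ) → ℕ
∑∈ []            g = 0
∑∈ (inside ∷ X)  g = g zero + ∑∈ X (g ∘ suc)
∑∈ (outside ∷ X) g = ∑∈ X (g ∘ suc)

syntax ∑∈ X (λ u → e) = ∑[ u ∈ X ] e

𝟙 : Bool → ℕ
𝟙 b = if b then 1 else 0

∑∈-cong : ∀ (X : Subset n) {g h} → (∀ u → g u ≡ h u) → ∑∈ X g ≡ ∑∈ X h
∑∈-cong []            g≗h = refl
∑∈-cong (inside ∷ X)  g≗h = cong₂ _+_ (g≗h zero) (∑∈-cong X (g≗h ∘ suc))
∑∈-cong (outside ∷ X) g≗h = ∑∈-cong X (g≗h ∘ suc)

∑∈-mono : ∀ (X : Subset n) {g h} → (∀ {u} → u ∈ X → g u ≤ h u) → ∑∈ X g ≤ ∑∈ X h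
∑∈-mono []            g≤h = z≤n
∑∈-mono (inside ∷ X)  g≤h = +-mono-≤ (g≤h here) (∑∈-mono X (g≤h ∘ there))
∑∈-mono (outside ∷ X) g≤h = ∑∈-mono X (g≤h ∘ there)

∑∈-const : ∀ (X : Subset n) c → ∑[ _ ∈ X ] c ≡ c * ∣ X ∣
∑∈-const []            c = ≡.sym (*-zeroʳ c)
∑∈-const (inside ∷ X)  c = trans (cong (c +_) (∑∈-const X c)) (≡.sym (*-suc c ∣ X ∣))
∑∈-const (outside ∷ X) c = ∑∈-const X c

∑∈-distrib-+ : ∀ (X : Subset n) g h → ∑[ u ∈ X ] (g u + h u) ≡ ∑∈ X g + ∑∈ X h
∑∈-distrib-+ []            g h = refl
∑∈-distrib-+ (inside ∷ X)  g h =
  trans (cong (g zero + h zero +_) (∑∈-distrib-+ X (g ∘ suc) (h ∘ suc)))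
        (interchange (g zero) (h zero) _ _)
∑∈-distrib-+ (outside ∷ X) g h = ∑∈-distrib-+ X (g ∘ suc) (h ∘ suc)

∑∈-comm : ∀ (X : Subset m) (Y : Subset n) (h : Fin m → Fin n → ℕ) →
          ∑[ u ∈ X ] ∑[ v ∈ Y ] h u v ≡ ∑[ v ∈ Y ] ∑[ u ∈ X ] h u v
∑∈-comm []            Y h = ≡.sym (∑∈-const Y 0)
∑∈-comm (inside ∷ X)  Y h =
  trans (cong (∑∈ Y (h zero) +_) (∑∈-comm X Y (h ∘ suc)))
        (≡.sym (∑∈-distrib-+ Y (h zero) _))
∑∈-comm (outside ∷ X) Y h = ∑∈-comm X Y (h ∘ suc)

∣p∩X∣≡∑∈X𝟙p : ∀ (p X : Subset n) → ∣ p ∩ X ∣ ≡ ∑[ u ∈ X ] 𝟙 (lookup p u)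
∣p∩X∣≡∑∈X𝟙p []            []            = refl
∣p∩X∣≡∑∈X𝟙p (inside ∷ p)  (inside ∷ X)  = cong suc (∣p∩X∣≡∑∈X𝟙p p X)
∣p∩X∣≡∑∈X𝟙p (outside ∷ p) (inside ∷ X)  = ∣p∩X∣≡∑∈X𝟙p p X
∣p∩X∣≡∑∈X𝟙p (inside ∷ p)  (outside ∷ X) = ∣p∩X∣≡∑∈X𝟙p p X
∣p∩X∣≡∑∈X𝟙p (outside ∷ p) (outside ∷ X) = ∣p∩X∣≡∑∈X𝟙p p X

∑∈-excess : ∀ (X : Subset n) {g h : Fin n → ℕ} → (∀ {u} → u ∈ X → g u ≤ suc (h u)) →
            ∑∈ X g ≤ ∑∈ X h + ∣ X ∩ ⟪ (λ u → h u <? g u) ⟫ ∣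
∑∈-excess []            g≤1+h = z≤n
∑∈-excess (outside ∷ X) g≤1+h = ∑∈-excess X (g≤1+h ∘ there)
∑∈-excess (inside ∷ X) {g} {h} g≤1+h with h zero <? g zero
... | yes _ = begin
  g zero + ∑∈ X (g ∘ suc)             ≤⟨ +-mono-≤ (g≤1+h here) (∑∈-excess X (g≤1+h ∘ there)) ⟩
  suc (h zero) + (∑∈ X (h ∘ suc) + c)  ≡⟨ cong suc (+-assoc (h zero) _ c) ⟨
  suc (h zero + ∑∈ X (h ∘ suc) + c)    ≡⟨ +-suc _ c ⟨
  h zero + ∑∈ X (h ∘ suc) + suc c      ∎
  where
  open ≤-Reasoning
  c : ℕ
  c = ∣ X ∩ ⟪ (λ u → h (suc u) <? g (suc u)) ⟫ ∣
... | no h≮g = begin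
  g zero + ∑∈ X (g ∘ suc)             ≤⟨ +-mono-≤ (≮⇒≥ h≮g) (∑∈-excess X (g≤1+h ∘ there)) ⟩
  h zero + (∑∈ X (h ∘ suc) + c)        ≡⟨ +-assoc (h zero) _ c ⟨
  h zero + ∑∈ X (h ∘ suc) + c          ∎
  where
  open ≤-Reasoning
  c : ℕ
  c = ∣ X ∩ ⟪ (λ u → h (suc u) <? g (suc u)) ⟫ ∣

module _ (G : Graph n) where

  lookup-N : ∀ u v → lookup (N G u) v ≡ adj G u v
  lookup-N u = lookup∘tabulate (adj G u)

  lookup-N-sym : ∀ u v → lookup (N G u) v ≡ lookup (N G v) u
  lookup-N-sym u v = trans (lookup-N u v) (trans (Graph.sym G u v) (≡.sym (lookup-N v u)))

  N-sym : ∀ {u v} → v ∈ N G u → u ∈ N G v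
  N-sym {u} {v} v∈Nu = lookup⇒[]= u (N G v) (trans (≡.sym (lookup-N-sym u v)) ([]=⇒lookup v∈Nu))

  u∉N[u] : ∀ u → u ∉ N G u
  u∉N[u] u u∈Nu with trans (≡.sym ([]=⇒lookup u∈Nu)) (trans (lookup-N u u) (irrefl G u))
  ... | ()

  N∩p⊆p-u : ∀ u (p : Subset n) → N G u ∩ p ⊆ p - u
  N∩p⊆p-u u p v∈ = let (v∈Nu , v∈p) = x∈p∩q⁻ (N G u) p v∈ in
    x∈p∧x≢y⇒x∈p-y v∈p λ { refl → u∉N[u] u v∈Nu }

  ∣N∩p∣<∣p∣ : ∀ {u} {p : Subset n} → u ∈ p → ∣ N G u ∩ p ∣ < ∣ p ∣
  ∣N∩p∣<∣p∣ {u} {p} u∈p = ≤-<-trans (p⊆q⇒∣p∣≤∣q∣ (N∩p⊆p-u u p)) (x∈p⇒∣p-x∣<∣p∣ u∈p)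

  ∑∣N∩Y∣≡∑∣N∩X∣ : ∀ (X Y : Subset n) → ∑[ u ∈ X ] ∣ N G u ∩ Y ∣ ≡ ∑[ v ∈ Y ] ∣ N G v ∩ X ∣
  ∑∣N∩Y∣≡∑∣N∩X∣ X Y = begin
    ∑[ u ∈ X ] ∣ N G u ∩ Y ∣                    ≡⟨ ∑∈-cong X (λ u → ∣p∩X∣≡∑∈X𝟙p (N G u) Y) ⟩
    ∑[ u ∈ X ] ∑[ v ∈ Y ] 𝟙 (lookup (N G u) v)  ≡⟨ ∑∈-comm X Y _ ⟩
    ∑[ v ∈ Y ] ∑[ u ∈ X ] 𝟙 (lookup (N G u) v)  ≡⟨ ∑∈-cong Y (λ v → ∑∈-cong X (λ u → cong 𝟙 (lookup-N-sym u v))) ⟩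
    ∑[ v ∈ Y ] ∑[ u ∈ X ] 𝟙 (lookup (N G v) u)  ≡⟨ ∑∈-cong Y (λ v → ∣p∩X∣≡∑∈X𝟙p (N G v) X) ⟨
    ∑[ v ∈ Y ] ∣ N G v ∩ X ∣                    ∎
    where open ≡-Reasoning

  module _ (r : ℕ) where

    -- step G r X is definitionally X ∪ ⟪ (λ v → r ≤? ∣ N G v ∩ X ∣) ⟫.
    X⊆step : ∀ X → X ⊆ step G r X
    X⊆step X = p⊆p∪q _

    infect : ∀ {X Y v} → Y ⊆ N G v ∩ X → r ≤ ∣ Y ∣ → v ∈ step G r X
    infect {X} Y⊆ r≤∣Y∣ =
      q⊆p∪q X _ (x∈⟪P⟫⁺ (λ v → r ≤? ∣ N G v ∩ X ∣) (≤-trans r≤∣Y∣ (p⊆q⇒∣p∣≤∣q∣ Y⊆)))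

    stage-mono : ∀ A {s t} → s ≤ t → stage G r A s ⊆ stage G r A t
    stage-mono A s≤t = mono (≤⇒≤′ s≤t)
      where
      mono : ∀ {s t} → s ≤′ t → stage G r A s ⊆ stage G r A t
      mono ≤′-refl        v∈ = v∈
      mono (≤′-step s≤′t) v∈ = X⊆step _ (mono s≤′t v∈)

    step-complete : ∀ X → (∀ v → r + ∣ ∁ X ∣ ≤ suc (deg G v)) → ∀ v → v ∈ step G r X
    step-complete X dense v with v ∈? X
    ... | yes v∈X = X⊆step X v∈X
    ... | no  v∉X = infect ⊆-refl (+-cancelʳ-≤ ∣ ∁ X ∣ r _ (begin
      r + ∣ ∁ X ∣                            ≤⟨ dense v ⟩
      suc (deg G v)                           ≡⟨ cong suc (∣p∣≡∣p∩q∣+∣p∩∁q∣ (N G v) X) ⟩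
      suc (∣ N G v ∩ X ∣ + ∣ N G v ∩ ∁ X ∣)  ≡⟨ +-suc _ _ ⟨
      ∣ N G v ∩ X ∣ + suc ∣ N G v ∩ ∁ X ∣    ≤⟨ +-monoʳ-≤ _ (∣N∩p∣<∣p∣ (x∉p⇒x∈∁p v∉X)) ⟩
      ∣ N G v ∩ X ∣ + ∣ ∁ X ∣                ∎))
      where open ≤-Reasoning

    ∣A∣<r⇒stage⊆A : ∀ A → ∣ A ∣ < r → ∀ t → stage G r A t ⊆ A
    ∣A∣<r⇒stage⊆A A ∣A∣<r zero    v∈ = v∈
    ∣A∣<r⇒stage⊆A A ∣A∣<r (suc t) {v} v∈ with x∈p∪q⁻ (stage G r A t) _ v∈
    ... | inj₁ v∈Aₜ  = ∣A∣<r⇒stage⊆A A ∣A∣<r t v∈Aₜ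
    ... | inj₂ v∈new = contradiction r≤∣A∣ (<⇒≱ ∣A∣<r)
      where
      open ≤-Reasoning
      r≤∣A∣ : r ≤ ∣ A ∣
      r≤∣A∣ = begin
        r                          ≤⟨ x∈⟪P⟫⁻ (λ v → r ≤? ∣ N G v ∩ stage G r A t ∣) v∈new ⟩
        ∣ N G v ∩ stage G r A t ∣  ≤⟨ ∣p∩q∣≤∣q∣ (N G v) (stage G r A t) ⟩
        ∣ stage G r A t ∣          ≤⟨ p⊆q⇒∣p∣≤∣q∣ (∣A∣<r⇒stage⊆A A ∣A∣<r t) ⟩
        ∣ A ∣                      ∎

    percolates⇒r≤∣A∣ : r ≤ n → ∀ A → Percolates G r A → r ≤ ∣ A ∣
    percolates⇒r≤∣A∣ r≤n A percolates with r ≤? ∣ A ∣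
    ... | yes r≤∣A∣ = r≤∣A∣
    ... | no  r≰∣A∣ = contradiction (≤-trans r≤n n≤∣A∣) r≰∣A∣
      where
      ⊤⊆A : ⊤ ⊆ A
      ⊤⊆A {v} _ = let (t , v∈Aₜ) = percolates v in ∣A∣<r⇒stage⊆A A (≰⇒> r≰∣A∣) t v∈Aₜ
      n≤∣A∣ : n ≤ ∣ A ∣
      n≤∣A∣ = subst (_≤ ∣ A ∣) (∣⊤∣≡n n) (p⊆q⇒∣p∣≤∣q∣ ⊤⊆A)

    closed⇒∣N∩A∣<r : ∀ A → Closed G r A → ∀ {v} → v ∉ A → ∣ N G v ∩ A ∣ < r
    closed⇒∣N∩A∣<r A closed {v} v∉A with r ≤? ∣ N G v ∩ A ∣
    ... | yes r≤ = contradiction (closed v (1 , infect ⊆-refl r≤)) v∉A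
    ... | no  r≰ = ≰⇒> r≰

a+b≤x+y⇒c+x≤a⇒c+b≤y : ∀ {a b c x y} → a + b ≤ x + y → c + x ≤ a → c + b ≤ y
a+b≤x+y⇒c+x≤a⇒c+b≤y {a} {b} {c} {x} {y} a+b≤x+y c+x≤a = +-cancelˡ-≤ x _ _ (begin
  x + (c + b)  ≡⟨ x∙yz≈yx∙z x c b ⟩
  c + x + b    ≤⟨ +-monoˡ-≤ b c+x≤a ⟩
  a + b        ≤⟨ a+b≤x+y ⟩
  x + y        ∎)
  where open ≤-Reasoning

a+b≤x+y⇒x≤c+b⇒a≤c+y : ∀ {a b c x y} → a + b ≤ x + y → x ≤ c + b → a ≤ c + y
a+b≤x+y⇒x≤c+b⇒a≤c+y {a} {b} {c} {x} {y} a+b≤x+y x≤c+b = +-cancelʳ-≤ b _ _ (begin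
  a + b        ≤⟨ a+b≤x+y ⟩
  x + y        ≤⟨ +-monoˡ-≤ y x≤c+b ⟩
  c + b + y    ≡⟨ xy∙z≈xz∙y c b y ⟩
  c + y + b    ∎)
  where open ≤-Reasoning

-- Here r = 4 + m, and ∣ A ∣ + 1 stands for ⌊n/2⌋.
module Construction (G : Graph n) (m : ℕ) (A : Subset n)
  (δ≥ : ∀ v → suc ∣ A ∣ + suc m ≤ deg G v)
  (n≤ : n ≤ ∣ A ∣ + (∣ A ∣ + 3))
  (∣A∣-large : (3 + m) * 3 + (5 + m) ≤ ∣ A ∣)
  (closedA : ∀ {v} → v ∉ A → ∣ N G v ∩ A ∣ ≤ 3 + m)
  where

  r α β : ℕ
  r = 4 + m
  α = ∣ A ∣
  β = ∣ ∁ A ∣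

  inA outA : Fin n → ℕ
  inA  u = ∣ N G u ∩ A ∣
  outA u = ∣ N G u ∩ ∁ A ∣

  δ≥inA+outA : ∀ u → suc α + suc m ≤ inA u + outA u
  δ≥inA+outA u = subst (suc α + suc m ≤_) (∣p∣≡∣p∩q∣+∣p∩∁q∣ (N G u) A) (δ≥ u)

  β≤α+3 : β ≤ α + 3
  β≤α+3 = +-cancelˡ-≤ α _ _ (subst (_≤ α + (α + 3)) (≡.sym (∣p∣+∣∁p∣≡n A)) n≤)

  outA-on-A : ∀ {u} → u ∈ A → 3 + m ≤ outA u
  outA-on-A {u} u∈A = a+b≤x+y⇒c+x≤a⇒c+b≤y (δ≥inA+outA u) (s≤s (∣N∩p∣<∣p∣ G u∈A))

  outA-off-A : ∀ {u} → u ∉ A → α ≤ suc (outA u)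
  outA-off-A {u} u∉A = ≤-pred (a+b≤x+y⇒x≤c+b⇒a≤c+y (δ≥inA+outA u) (closedA u∉A))

  Q P : Subset n
  Q = A ∩ ⟪ (λ u → outA u <? 4 + m) ⟫
  P = ∁ A ∩ ⟪ (λ u → 2 + m <? inA u) ⟫

  Q⊆A : Q ⊆ A
  Q⊆A = p∩q⊆p A _

  P⊆∁A : P ⊆ ∁ A
  P⊆∁A = p∩q⊆p (∁ A) _

  outA-on-Q : ∀ {q} → q ∈ Q → outA q ≤ 3 + m
  outA-on-Q q∈Q = ≤-pred (x∈⟪P⟫⁻ (λ u → outA u <? 4 + m) (p∩q⊆q A _ q∈Q))

  inA-on-P : ∀ {b} → b ∈ P → 3 + m ≤ inA b
  inA-on-P b∈P = x∈⟪P⟫⁻ (λ u → 2 + m <? inA u) (p∩q⊆q (∁ A) _ b∈P)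

  -- A vertex of Q has at most 3 + m neighbours outside A, so the degree bound
  -- forces all of A - q into its neighbourhood.
  Q-adj : ∀ {q w} → q ∈ Q → w ∈ A → w ≢ q → w ∈ N G q
  Q-adj {q} {w} q∈Q w∈A w≢q =
    p∩q⊆p (N G q) A (p⊆q∧∣q∣≤∣p∣⇒q⊆p (N∩p⊆p-u G q A) ∣A-q∣≤inA (x∈p∧x≢y⇒x∈p-y w∈A w≢q))
    where
    α≤1+inA : α ≤ suc (inA q)
    α≤1+inA = ≤-pred (a+b≤x+y⇒x≤c+b⇒a≤c+y
      (subst (suc α + suc m ≤_) (+-comm (inA q) (outA q)) (δ≥inA+outA q)) (outA-on-Q q∈Q))
    ∣A-q∣≤inA : ∣ A - q ∣ ≤ inA q
    ∣A-q∣≤inA = ≤-pred (≤-trans (x∈p⇒∣p-x∣<∣p∣ (Q⊆A q∈Q)) α≤1+inA)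

  α≤c*3+x : ∀ c x → suc c * α ≤ c * β + x → α ≤ c * 3 + x
  α≤c*3+x c x sc*α≤c*β+x = +-cancelˡ-≤ (c * α) _ _ (begin
    c * α + α            ≡⟨ +-comm (c * α) α ⟩
    suc c * α            ≤⟨ sc*α≤c*β+x ⟩
    c * β + x            ≤⟨ +-monoˡ-≤ x (*-monoʳ-≤ c β≤α+3) ⟩
    c * (α + 3) + x      ≡⟨ cong (_+ x) (*-distribˡ-+ c α 3) ⟩
    c * α + c * 3 + x    ≡⟨ +-assoc (c * α) (c * 3) x ⟩
    c * α + (c * 3 + x)  ∎)
    where open ≤-Reasoning

  E : ℕ
  E = ∑[ u ∈ A ] outA u

  E≡∑inA : E ≡ ∑[ v ∈ ∁ A ] inA v
  E≡∑inA = ∑∣N∩Y∣≡∑∣N∩X∣ G A (∁ A)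

  5+m≤∣Q∣ : 5 + m ≤ ∣ Q ∣
  5+m≤∣Q∣ = +-cancelˡ-≤ ((3 + m) * 3) _ _ (≤-trans ∣A∣-large (α≤c*3+x (3 + m) ∣ Q ∣ (begin
    (4 + m) * α                   ≡⟨ ∑∈-const A (4 + m) ⟨
    ∑[ _ ∈ A ] (4 + m)            ≤⟨ ∑∈-excess A {g = λ _ → 4 + m} {h = outA} (s≤s ∘ outA-on-A) ⟩
    E + ∣ Q ∣                     ≡⟨ cong (_+ ∣ Q ∣) E≡∑inA ⟩
    ∑[ v ∈ ∁ A ] inA v + ∣ Q ∣    ≤⟨ +-monoˡ-≤ ∣ Q ∣ (∑∈-mono (∁ A) (closedA ∘ x∈∁p⇒x∉p)) ⟩
    ∑[ _ ∈ ∁ A ] (3 + m) + ∣ Q ∣  ≡⟨ cong (_+ ∣ Q ∣) (∑∈-const (∁ A) (3 + m)) ⟩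
    (3 + m) * β + ∣ Q ∣           ∎)))
    where open ≤-Reasoning

  7≤∣P∣ : 7 ≤ ∣ P ∣
  7≤∣P∣ = +-cancelˡ-≤ ((2 + m) * 3) _ _ (≤-trans margin (≤-trans ∣A∣-large (α≤c*3+x (2 + m) ∣ P ∣ (begin
    (3 + m) * α                   ≡⟨ ∑∈-const A (3 + m) ⟨
    ∑[ _ ∈ A ] (3 + m)            ≤⟨ ∑∈-mono A outA-on-A ⟩
    E                             ≡⟨ E≡∑inA ⟩
    ∑[ v ∈ ∁ A ] inA v            ≤⟨ ∑∈-excess (∁ A) {g = inA} {h = λ _ → 2 + m} (closedA ∘ x∈∁p⇒x∉p) ⟩
    ∑[ _ ∈ ∁ A ] (2 + m) + ∣ P ∣  ≡⟨ cong (_+ ∣ P ∣) (∑∈-const (∁ A) (2 + m)) ⟩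
    (2 + m) * β + ∣ P ∣           ∎))))
    where
    open ≤-Reasoning
    margin : (2 + m) * 3 + 7 ≤ (3 + m) * 3 + (5 + m)
    margin = subst ((2 + m) * 3 + 7 ≤_) (≡.sym (identity m)) (m≤m+n _ (1 + m))
      where
      identity : ∀ m → (3 + m) * 3 + (5 + m) ≡ (2 + m) * 3 + 7 + (1 + m)
      identity = solve-∀

  4+m≤∣Q-w∣ : ∀ w → 4 + m ≤ ∣ Q - w ∣
  4+m≤∣Q-w∣ w = ≤-pred (≤-trans 5+m≤∣Q∣ (∣p∣≤1+∣p-x∣ Q w))

  module Seed {b₀ a₁ : Fin n} {R : Subset n}
    (b₀∈P : b₀ ∈ P) (a₁∈N[b₀]∩A : a₁ ∈ N G b₀ ∩ A) (R⊆Q-a₁ : R ⊆ Q - a₁) (∣R∣≡3+m : ∣ R ∣ ≡ 3 + m)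
    where

    S : Subset n
    S = ⁅ b₀ ⁆ ∪ R

    J : ℕ → Subset n
    J = stage G r S

    b₀∉A : b₀ ∉ A
    b₀∉A = x∈∁p⇒x∉p (P⊆∁A b₀∈P)

    a₁∈A : a₁ ∈ A
    a₁∈A = p∩q⊆q (N G b₀) A a₁∈N[b₀]∩A

    R⊆Q : R ⊆ Q
    R⊆Q u∈R = proj₁ (x∈p-y⁻ (R⊆Q-a₁ u∈R))

    a₁∉R : a₁ ∉ R
    a₁∉R a₁∈R = proj₂ (x∈p-y⁻ (R⊆Q-a₁ a₁∈R)) refl

    ∣⁅x⁆∪R∣≡r : ∀ {x} → x ∉ R → ∣ ⁅ x ⁆ ∪ R ∣ ≡ r
    ∣⁅x⁆∪R∣≡r x∉R = trans (∣⁅x⁆∪p∣≡1+∣p∣ R x∉R) (cong suc ∣R∣≡3+m)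

    ∣S∣≡r : ∣ S ∣ ≡ r
    ∣S∣≡r = ∣⁅x⁆∪R∣≡r (b₀∉A ∘ Q⊆A ∘ R⊆Q)

    R⊆J : ∀ t → R ⊆ J t
    R⊆J t u∈R = stage-mono G r S {t = t} z≤n (q⊆p∪q ⁅ b₀ ⁆ R u∈R)

    b₀∈J : ∀ t → b₀ ∈ J t
    b₀∈J t = stage-mono G r S {t = t} z≤n (p⊆p∪q R (x∈⁅x⁆ b₀))

    R⊆N : ∀ {q} → q ∈ A → q ∉ R → R ⊆ N G q
    R⊆N q∈A q∉R u∈R = N-sym G (Q-adj (R⊆Q u∈R) q∈A λ { refl → q∉R u∈R })

    a₁∈J₁ : a₁ ∈ J 1
    a₁∈J₁ = infect G r (⊆-∩ (∪⊆ (⁅x⁆⊆p b₀∈N[a₁]) (R⊆N a₁∈A a₁∉R)) ⊆-refl)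
                       (≤-reflexive (≡.sym ∣S∣≡r))
      where
      b₀∈N[a₁] : b₀ ∈ N G a₁
      b₀∈N[a₁] = N-sym G (p∩q⊆p (N G b₀) A a₁∈N[b₀]∩A)

    Q⊆J₂ : Q ⊆ J 2
    Q⊆J₂ {q} q∈Q with q ∈? R | q Fin.≟ a₁
    ... | yes q∈R | _        = R⊆J 2 q∈R
    ... | no  _   | yes refl = stage-mono G r S {t = 2} (s≤s z≤n) a₁∈J₁
    ... | no  q∉R | no  q≢a₁ = infect G r
      (⊆-∩ (∪⊆ (⁅x⁆⊆p (Q-adj q∈Q a₁∈A (q≢a₁ ∘ ≡.sym))) (R⊆N (Q⊆A q∈Q) q∉R))
           (∪⊆ (⁅x⁆⊆p a₁∈J₁) (R⊆J 1)))
      (≤-reflexive (≡.sym (∣⁅x⁆∪R∣≡r a₁∉R)))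

    A⊆J₃ : A ⊆ J 3
    A⊆J₃ {w} w∈A = infect G r (⊆-∩ Q-w⊆N[w] (Q⊆J₂ ∘ proj₁ ∘ x∈p-y⁻)) (4+m≤∣Q-w∣ w)
      where
      Q-w⊆N[w] : Q - w ⊆ N G w
      Q-w⊆N[w] u∈Q-w = let (u∈Q , u≢w) = x∈p-y⁻ u∈Q-w in
        N-sym G (Q-adj u∈Q w∈A (u≢w ∘ ≡.sym))

    P∩N[b₀]⊆J₄ : P ∩ N G b₀ ⊆ J 4
    P∩N[b₀]⊆J₄ {b} b∈ = infect G r
      (⊆-∩ (∪⊆ (⁅x⁆⊆p (N-sym G (p∩q⊆q P (N G b₀) b∈))) (p∩q⊆p (N G b) A))
           (∪⊆ (⁅x⁆⊆p (b₀∈J 3)) (A⊆J₃ ∘ p∩q⊆q (N G b) A)))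
      (subst (r ≤_) (≡.sym (∣⁅x⁆∪p∣≡1+∣p∣ (N G b ∩ A) (b₀∉A ∘ p∩q⊆q (N G b) A)))
        (s≤s (inA-on-P (p∩q⊆p P (N G b₀) b∈))))

    3≤∣P∩N[b₀]∣ : 3 ≤ ∣ P ∩ N G b₀ ∣
    3≤∣P∩N[b₀]∣ = +-cancelˡ-≤ (α + 4) 3 _ (begin
      α + 4 + 3                      ≡⟨ +-comm (α + 4) 3 ⟩
      3 + (α + 4)                    ≡⟨ cong (3 +_) (+-comm α 4) ⟩
      7 + α                          ≤⟨ +-mono-≤ 7≤∣P∣ (outA-off-A b₀∉A) ⟩
      ∣ P ∣ + suc (outA b₀)          ≡⟨ +-suc ∣ P ∣ (outA b₀) ⟩
      suc (∣ P ∣ + outA b₀)          ≡⟨ cong suc (∣p∪q∣+∣p∩q∣≡∣p∣+∣q∣ P Y) ⟨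
      suc (∣ P ∪ Y ∣ + ∣ P ∩ Y ∣)    ≤⟨ s≤s (+-mono-≤ (p⊆q⇒∣p∣≤∣q∣ P∪Y⊆∁A) (p⊆q⇒∣p∣≤∣q∣ P∩Y⊆P∩N[b₀])) ⟩
      suc (β + ∣ P ∩ N G b₀ ∣)      ≤⟨ s≤s (+-monoˡ-≤ _ β≤α+3) ⟩
      suc (α + 3 + ∣ P ∩ N G b₀ ∣)  ≡⟨ cong (_+ ∣ P ∩ N G b₀ ∣) (+-suc α 3) ⟨
      α + 4 + ∣ P ∩ N G b₀ ∣        ∎)
      where
      open ≤-Reasoning
      Y : Subset n
      Y = N G b₀ ∩ ∁ A
      P∪Y⊆∁A : P ∪ Y ⊆ ∁ A
      P∪Y⊆∁A = ∪⊆ P⊆∁A (p∩q⊆q (N G b₀) (∁ A))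
      P∩Y⊆P∩N[b₀] : P ∩ Y ⊆ P ∩ N G b₀
      P∩Y⊆P∩N[b₀] x∈ = let (x∈P , x∈Y) = x∈p∩q⁻ P Y x∈ in x∈p∩q⁺ (x∈P , p∩q⊆p (N G b₀) (∁ A) x∈Y)

    α+4≤∣J₄∣ : α + 4 ≤ ∣ J 4 ∣
    α+4≤∣J₄∣ = begin
      α + 4                                  ≤⟨ +-monoʳ-≤ α (s≤s 3≤∣P∩N[b₀]∣) ⟩
      α + suc ∣ P ∩ N G b₀ ∣                 ≡⟨ cong (α +_) (∣⁅x⁆∪p∣≡1+∣p∣ (P ∩ N G b₀) b₀∉P∩N[b₀]) ⟨
      α + ∣ ⁅ b₀ ⁆ ∪ (P ∩ N G b₀) ∣          ≡⟨ ∣p∪q∣≡∣p∣+∣q∣ A (⁅ b₀ ⁆ ∪ (P ∩ N G b₀)) disjoint ⟨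
      ∣ A ∪ (⁅ b₀ ⁆ ∪ (P ∩ N G b₀)) ∣        ≤⟨ p⊆q⇒∣p∣≤∣q∣ (∪⊆ A⊆J₄ (∪⊆ (⁅x⁆⊆p (b₀∈J 4)) P∩N[b₀]⊆J₄)) ⟩
      ∣ J 4 ∣                                ∎
      where
      open ≤-Reasoning
      b₀∉P∩N[b₀] : b₀ ∉ P ∩ N G b₀
      b₀∉P∩N[b₀] = u∉N[u] G b₀ ∘ p∩q⊆q P (N G b₀)
      A⊆J₄ : A ⊆ J 4
      A⊆J₄ = stage-mono G r S {t = 4} (s≤s (s≤s (s≤s z≤n))) ∘ A⊆J₃
      disjoint : ∀ {x} → x ∈ A → x ∉ ⁅ b₀ ⁆ ∪ (P ∩ N G b₀)
      disjoint x∈A x∈ = x∈∁p⇒x∉p (∪⊆ (⁅x⁆⊆p (x∉p⇒x∈∁p b₀∉A)) (P⊆∁A ∘ p∩q⊆p P (N G b₀)) x∈) x∈A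

    ∣∁J₄∣<α : ∣ ∁ (J 4) ∣ < α
    ∣∁J₄∣<α = ≤-pred (≤-pred (≤-pred (subst (4 + ∣ ∁ (J 4) ∣ ≤_) (+-comm α 3) (+-cancelˡ-≤ α _ _ (begin
      α + (4 + ∣ ∁ (J 4) ∣)    ≡⟨ +-assoc α 4 _ ⟨
      α + 4 + ∣ ∁ (J 4) ∣      ≤⟨ +-monoˡ-≤ _ α+4≤∣J₄∣ ⟩
      ∣ J 4 ∣ + ∣ ∁ (J 4) ∣    ≡⟨ ∣p∣+∣∁p∣≡n (J 4) ⟩
      n                        ≤⟨ n≤ ⟩
      α + (α + 3)              ∎)))))
      where open ≤-Reasoning

    ∁J₄-small : ∀ v → r + ∣ ∁ (J 4) ∣ ≤ suc (deg G v)
    ∁J₄-small v = begin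
      4 + m + c                  ≡⟨ cong (3 +_) (trans (cong suc (+-comm m c)) (≡.sym (+-suc c m))) ⟩
      suc (suc (suc c) + suc m)  ≤⟨ s≤s (+-monoˡ-≤ (suc m) (s≤s ∣∁J₄∣<α)) ⟩
      suc (suc α + suc m)        ≤⟨ s≤s (δ≥ v) ⟩
      suc (deg G v)              ∎
      where
      open ≤-Reasoning
      c : ℕ
      c = ∣ ∁ (J 4) ∣

    S-percolates : Percolates G r S
    S-percolates v = 5 , step-complete G r (J 4) ∁J₄-small v

  percolating-set : ∃ λ S → Percolates G r S × ∣ S ∣ ≡ r
  percolating-set =
    let (b₀ , b₀∈P)            = ∣p∣>0⇒Nonempty P (≤-trans (s≤s z≤n) 7≤∣P∣)
        (a₁ , a₁∈N[b₀]∩A)      = ∣p∣>0⇒Nonempty (N G b₀ ∩ A) (≤-trans (s≤s z≤n) (inA-on-P b₀∈P))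
        (R , R⊆Q-a₁ , ∣R∣≡3+m) = ∃-⊆-of-size (Q - a₁) (≤-trans (n≤1+n _) (4+m≤∣Q-w∣ a₁))
        open Seed b₀∈P a₁∈N[b₀]∩A R⊆Q-a₁ ∣R∣≡3+m
    in S , S-percolates , ∣S∣≡r

module Halving {n a B : ℕ} (2[1+B]≤n : suc B * 2 ≤ n) (a≡⌊n/2⌋∸1 : a ≡ n / 2 ∸ 1) where

  1+B≤⌊n/2⌋ : suc B ≤ n / 2
  1+B≤⌊n/2⌋ = subst (_≤ n / 2) (m*n/n≡m (suc B) 2) (/-monoˡ-≤ 2 2[1+B]≤n)

  ⌊n/2⌋≡1+a : n / 2 ≡ suc a
  ⌊n/2⌋≡1+a = trans (≡.sym (m+[n∸m]≡n (≤-trans (s≤s z≤n) 1+B≤⌊n/2⌋))) (cong suc (≡.sym a≡⌊n/2⌋∸1))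

  B≤a : B ≤ a
  B≤a = ≤-pred (subst (suc B ≤_) ⌊n/2⌋≡1+a 1+B≤⌊n/2⌋)

  n≤a+[a+3] : n ≤ a + (a + 3)
  n≤a+[a+3] = begin
    n                  ≡⟨ m≡m%n+[m/n]*n n 2 ⟩
    n % 2 + n / 2 * 2  ≤⟨ +-monoˡ-≤ (n / 2 * 2) (≤-pred (m%n<n n 2)) ⟩
    1 + n / 2 * 2      ≡⟨ cong (λ k → 1 + k * 2) ⌊n/2⌋≡1+a ⟩
    1 + suc a * 2      ≡⟨ identity a ⟩
    a + (a + 3)        ∎
    where
    open ≤-Reasoning
    identity : ∀ a → 1 + suc a * 2 ≡ a + (a + 3)
    identity = solve-∀

proposition4p4 : ∀ (r : ℕ) → r ≥ 4 →
    ∃ λ (n₀ : ℕ) → ∀ (n : ℕ) → n ≥ n₀ →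
      ∀ (G : Graph n) →
        MinDegAtLeast G (n / 2 + (r ∸ 3)) →
        (∃ λ (A : Subset n) → ∣ A ∣ ≡ n / 2 ∸ 1 × Closed G r A) →
        MinPercolating≡ G r r
proposition4p4 r@(suc (suc (suc (suc m)))) (s≤s (s≤s (s≤s (s≤s z≤n)))) = suc B * 2 , extremal
  where
  B : ℕ
  B = (3 + m) * 3 + (5 + m)

  extremal : ∀ n → n ≥ suc B * 2 → (G : Graph n) → MinDegAtLeast G (n / 2 + (r ∸ 3)) →
             (∃ λ (A : Subset n) → ∣ A ∣ ≡ n / 2 ∸ 1 × Closed G r A) → MinPercolating≡ G r r
  extremal n n₀≤n G δ≥ (A , ∣A∣≡ , closed) =
      Construction.percolating-set G m A δ≥′ n≤a+[a+3] B≤a (≤-pred ∘ closed⇒∣N∩A∣<r G r A closed)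
    , percolates⇒r≤∣A∣ G r r≤n
    where
    open Halving {B = B} n₀≤n ∣A∣≡
    δ≥′ : ∀ v → suc ∣ A ∣ + suc m ≤ deg G v
    δ≥′ v = subst (λ k → k + suc m ≤ deg G v) ⌊n/2⌋≡1+a (δ≥ v)
    r≤n : r ≤ n
    r≤n = ≤-trans (n≤1+n r) (≤-trans (m≤n+m (5 + m) ((3 + m) * 3)) (≤-trans B≤a (∣p∣≤n A)))
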